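{- Let $G$ be an $n$-vertex graph with clique number $k$. Then $G$ contains at most $2^k(2n-1)$ connected modules.
   Context: All graphs are finite and simple. The clique number of $G$ is the maximum cardinality of a set of pairwise adjacent vertices. A module of $G$ is a nonempty set $M \subseteq V(G)$ such that every vertex $u \in V(G)\setminus M$ is adjacent either to all vertices of $M$ or to no vertex of $M$. A module $M$ is connected if the induced subgraph $G[M]$ is connected. -}

module Defs where

open import Data.Nat using (ℕ; _≤_)
open import Data.Fin using (Fin)
open import Data.Fin.Subset using (Subset; _∈_; _∉_; ∣_∣; Nonempty)
open import Data.Product using (_×_; Σ; ∃)
open import Data.Sum using (_⊎_)
open import Relation.Nullary using (¬_)
open import Relation.Binary.PropositionalEquality using (_≡_)

record Graph (n : ℕ) : Set₁ where
  field
    Adj   : Fin n → Fin n → Set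
    sym   : ∀ {u v} → Adj u v → Adj v u
    irrefl : ∀ {u} → ¬ Adj u u

open Graph public

module _ {n : ℕ} (G : Graph n) where

  IsClique : Subset n → Set
  IsClique C = ∀ u v → u ∈ C → v ∈ C → ¬ (u ≡ v) → Adj G u v

  CliqueNumber : ℕ → Set
  CliqueNumber k =
    (Σ (Subset n) λ C → IsClique C × ∣ C ∣ ≡ k)
    × (∀ C → IsClique C → ∣ C ∣ ≤ k)

  IsModule : Subset n → Set
  IsModule M = Nonempty M ×
    (∀ u → u ∉ M →
      (∀ v → v ∈ M → Adj G u v) ⊎ (∀ v → v ∈ M → ¬ Adj G u v))

  data PathIn (M : Subset n) : Fin n → Fin n → Set where
    here : ∀ {u} → u ∈ M → PathIn M u u
    step : ∀ {u v w} → u ∈ M → Adj G u v → PathIn M v w → PathIn M u w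

  InducedConnected : Subset n → Set
  InducedConnected M = ∀ u v → u ∈ M → v ∈ M → PathIn M u v

  IsConnectedModule : Subset n → Set
  IsConnectedModule M = IsModule M × InducedConnected M

-- For a vertex set U and a nonempty S, count the connected modules of G[U] containing S.
-- If no vertex of U is adjacent to all of S there is at most one: a walk inside one such
-- module M from S to a vertex outside another one N leaves N along an edge wz, and z ∉ N,
-- seeing w ∈ N, sees all of N ⊇ S. Otherwise take such a common neighbour x and split on
-- x ∈ M: modules containing x contain S ∪ {x}, while modules avoiding x are seen entirely
-- by x (as x sees S ⊆ M), so they lie in U ∩ N(x). Either way x extends every clique of
-- new common neighbours to a clique of old ones, so when cliques of common neighbours have
-- at most j vertices, induction on j bounds the count by 2^j. Adding the vertices one at a
-- time, with S the new vertex, bounds the number of connected modules by 2^ω · n.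
module Submission where

open import Defs
open import Data.Nat using (ℕ; _≤_; _*_; _^_; _∸_)
open import Data.List using (List; length)
open import Data.List.Relation.Unary.All using (All)
open import Data.List.Relation.Unary.Unique.Propositional using (Unique)
open import Data.Fin.Subset using (Subset)

open import Level using (0ℓ)
open import Function using (_∘_)
open import Data.Nat using (zero; suc; _+_; _<_; _≤?_; z≤n; s≤s)
open import Data.Nat.Properties
  using (≤-trans; ≤-reflexive; +-mono-≤; +-suc; +-identityʳ; *-suc; *-monoʳ-≤;
         m^n>0; m≤m+n; m<n⇒m<1+n; ≤∧≢⇒<; <⇒≤; ≤-pred; ≤-refl)
open import Data.Fin using (Fin; toℕ; fromℕ<)
open import Data.Fin.Properties using (toℕ-fromℕ<; toℕ-injective; toℕ<n)
open import Data.Fin.Subset using (_∈_; _∉_; ∣_∣; Nonempty; ⁅_⁆; _∪_)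
  renaming (_⊆_ to _⊆ˢ_)
open import Data.Fin.Subset.Properties
  using (_∈?_; x∈⁅x⁆; x∈⁅y⁆⇒x≡y; ∣⁅x⁆∣≡1; p⊆p∪q; q⊆p∪q; x∈p∪q⁻; p⊂q⇒∣p∣<∣q∣; ⊆-antisym)
open import Data.List using ([]; _∷_; filter)
open import Data.List.Relation.Unary.All as All using ([]; _∷_)
open import Data.List.Relation.Unary.All.Properties using (all-filter)
  renaming (filter⁺ to All-filter⁺)
open import Data.List.Relation.Unary.Unique.Propositional.Properties
  renaming (filter⁺ to Unique-filter⁺)
open import Data.List.Relation.Unary.AllPairs using ([]; _∷_)
open import Data.Product using (_×_; _,_; proj₁; proj₂; ∃)
open import Data.Sum using (_⊎_; inj₁; inj₂)
open import Data.Bool using (true; false)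
open import Relation.Nullary using (¬_; Dec; yes; no; does; contradiction)
open import Relation.Nullary.Decidable using (decidable-stable; ¬¬-excluded-middle)
open import Relation.Unary using (Pred; Decidable; Satisfiable; _∩_; ∁)
  renaming (_⊆_ to _⊆ᵖ_)
open import Relation.Unary.Properties using (∁?)
open import Relation.Binary.PropositionalEquality as ≡ using (_≡_; refl; trans; cong; subst)

decidable-byCases : {A B : Set} → Dec B → (Dec A → B) → B
decidable-byCases B? f = decidable-stable B? (λ ¬b → ¬¬-excluded-middle (¬b ∘ f))

∣p∣<∣p∪⁅x⁆∣ : ∀ {n} {p : Subset n} {x : Fin n} → x ∉ p → ∣ p ∣ < ∣ p ∪ ⁅ x ⁆ ∣
∣p∣<∣p∪⁅x⁆∣ {p = p} {x} x∉p =
  p⊂q⇒∣p∣<∣q∣ (p⊆p∪q ⁅ x ⁆ , x , q⊆p∪q p ⁅ x ⁆ (x∈⁅x⁆ x) , x∉p)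

module _ {a} {A : Set a} where

  AtMost : ∀ {ℓ} → ℕ → Pred A ℓ → Set _
  AtMost m R = ∀ {xs} → Unique xs → All R xs → length xs ≤ m

  atMost-weaken : ∀ {ℓ} {R : Pred A ℓ} {m m′} → m ≤ m′ → AtMost m R → AtMost m′ R
  atMost-weaken m≤m′ bound uniq all = ≤-trans (bound uniq all) m≤m′

  atMost-⊆ : ∀ {ℓ ℓ′} {R : Pred A ℓ} {R′ : Pred A ℓ′} {m} → R ⊆ᵖ R′ → AtMost m R′ → AtMost m R
  atMost-⊆ R⊆R′ bound uniq all = bound uniq (All.map R⊆R′ all)

  atMost-one : ∀ {ℓ} {R : Pred A ℓ} → (∀ {x y} → R x → R y → x ≡ y) → AtMost 1 R
  atMost-one unique {[]}        _                  _              = z≤n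
  atMost-one unique {_ ∷ []}    _                  _              = s≤s z≤n
  atMost-one unique {_ ∷ _ ∷ _} ((x≢y ∷ _) ∷ _) (Rx ∷ Ry ∷ _) = contradiction (unique Rx Ry) x≢y

  module _ {p} {P : Pred A p} (P? : Decidable P) where

    length-filter+length-filter∁ : ∀ xs →
      length (filter P? xs) + length (filter (∁? P?) xs) ≡ length xs
    length-filter+length-filter∁ []       = refl
    length-filter+length-filter∁ (x ∷ xs) with does (P? x)
    ... | true  = cong suc (length-filter+length-filter∁ xs)
    ... | false = trans (+-suc _ _) (cong suc (length-filter+length-filter∁ xs))

    atMost-split : ∀ {ℓ} {R : Pred A ℓ} {m m′} →
      AtMost m (R ∩ P) → AtMost m′ (R ∩ ∁ P) → AtMost (m + m′) R
    atMost-split {R = R} {m} {m′} inP outP {xs} uniq all = begin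
      length xs                                          ≡⟨ length-filter+length-filter∁ xs ⟨
      length (filter P? xs) + length (filter (∁? P?) xs) ≤⟨ +-mono-≤ (filtered P? inP) (filtered (∁? P?) outP) ⟩
      m + m′                                             ∎
      where
      open Data.Nat.Properties.≤-Reasoning
      filtered : ∀ {q} {Q : Pred A q} (Q? : Decidable Q) {b} → AtMost b (R ∩ Q) → length (filter Q? xs) ≤ b
      filtered Q? bound = bound (Unique-filter⁺ Q? uniq) (All.zip (All-filter⁺ Q? all , all-filter Q? xs))

module _ {n : ℕ} (G : Graph n) where

  AllOrNone : Subset n → Fin n → Set
  AllOrNone M u = (∀ v → v ∈ M → Adj G u v) ⊎ (∀ v → v ∈ M → ¬ Adj G u v)

  IsConnectedModuleIn : Pred (Fin n) 0ℓ → Subset n → Set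
  IsConnectedModuleIn U M =
    Nonempty M × (∀ {y} → y ∈ M → U y) × (∀ u → U u → u ∉ M → AllOrNone M u)
    × InducedConnected G M

  IsConnectedModuleContaining : Pred (Fin n) 0ℓ → Pred (Fin n) 0ℓ → Subset n → Set
  IsConnectedModuleContaining U S M = IsConnectedModuleIn U M × (∀ {y} → S y → y ∈ M)

  CommonNeighbour : Pred (Fin n) 0ℓ → Pred (Fin n) 0ℓ → Fin n → Set
  CommonNeighbour U S y = U y × (∀ {s} → S s → Adj G y s)

  CommonNeighbourCliqueBound : Pred (Fin n) 0ℓ → Pred (Fin n) 0ℓ → ℕ → Set
  CommonNeighbourCliqueBound U S j =
    ∀ C → IsClique G C → (∀ {y} → y ∈ C → CommonNeighbour U S y) → ∣ C ∣ ≤ j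

  IsClique-⁅⁆ : ∀ x → IsClique G ⁅ x ⁆
  IsClique-⁅⁆ x u v u∈ v∈ u≢v = contradiction (trans (x∈⁅y⁆⇒x≡y x u∈) (≡.sym (x∈⁅y⁆⇒x≡y x v∈))) u≢v

  IsClique-∪⁅⁆ : ∀ {C x} → IsClique G C → (∀ {y} → y ∈ C → Adj G x y) → IsClique G (C ∪ ⁅ x ⁆)
  IsClique-∪⁅⁆ {C} {x} clique adj u v u∈ v∈ u≢v with x∈p∪q⁻ C ⁅ x ⁆ u∈ | x∈p∪q⁻ C ⁅ x ⁆ v∈
  ... | inj₁ u∈C | inj₁ v∈C = clique u v u∈C v∈C u≢v
  ... | inj₁ u∈C | inj₂ v≡x rewrite x∈⁅y⁆⇒x≡y x v≡x = Graph.sym G (adj u∈C)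
  ... | inj₂ u≡x | inj₁ v∈C rewrite x∈⁅y⁆⇒x≡y x u≡x = adj v∈C
  ... | inj₂ u≡x | inj₂ v≡x = IsClique-⁅⁆ x u v u≡x v≡x u≢v

  cliqueBound-zero : ∀ {U S x} → CommonNeighbourCliqueBound U S 0 → ¬ CommonNeighbour U S x
  cliqueBound-zero {U} {S} {x} bound x∈N =
    contradiction (subst (_≤ 0) (∣⁅x⁆∣≡1 x) (bound ⁅ x ⁆ (IsClique-⁅⁆ x) ⁅x⁆⊆N)) λ ()
    where
    ⁅x⁆⊆N : ∀ {y} → y ∈ ⁅ x ⁆ → CommonNeighbour U S y
    ⁅x⁆⊆N y∈ rewrite x∈⁅y⁆⇒x≡y x y∈ = x∈N

  cliqueBound-pred : ∀ {U S U′ S′ x j} →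
    CommonNeighbourCliqueBound U S (suc j) → CommonNeighbour U S x →
    (∀ {y} → CommonNeighbour U′ S′ y → CommonNeighbour U S y × Adj G x y) →
    CommonNeighbourCliqueBound U′ S′ j
  cliqueBound-pred {U} {S} {x = x} bound x∈N reduce C clique C⊆N′ =
    ≤-pred (≤-trans (∣p∣<∣p∪⁅x⁆∣ x∉C) (bound (C ∪ ⁅ x ⁆) (IsClique-∪⁅⁆ clique adjX) C∪x⊆N))
    where
    adjX : ∀ {y} → y ∈ C → Adj G x y
    adjX = proj₂ ∘ reduce ∘ C⊆N′
    x∉C : x ∉ C
    x∉C x∈C = irrefl G (adjX x∈C)
    C∪x⊆N : ∀ {y} → y ∈ C ∪ ⁅ x ⁆ → CommonNeighbour U S y
    C∪x⊆N {y} y∈ with x∈p∪q⁻ C ⁅ x ⁆ y∈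
    ... | inj₁ y∈C = proj₁ (reduce (C⊆N′ y∈C))
    ... | inj₂ y≡x rewrite x∈⁅y⁆⇒x≡y x y≡x = x∈N

  path-head : ∀ {M a b} → PathIn G M a b → a ∈ M
  path-head (here a∈M)     = a∈M
  path-head (step a∈M _ _) = a∈M

  path-crossing : ∀ {M a b} (N : Subset n) → PathIn G M a b → a ∈ N → b ∉ N →
    ∃ λ w → ∃ λ z → w ∈ N × z ∉ N × z ∈ M × Adj G w z
  path-crossing N (here _) a∈N b∉N = contradiction a∈N b∉N
  path-crossing N (step {u} {v} _ uv path) u∈N b∉N with v ∈? N
  ... | yes v∈N = path-crossing N path v∈N b∉N
  ... | no  v∉N = u , v , u∈N , v∉N , path-head path , uv

  connectedModuleContaining-⊆ : ∀ {U S M N} → Satisfiable S → (∀ {z} → ¬ CommonNeighbour U S z) →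
    IsConnectedModuleContaining U S M → IsConnectedModuleContaining U S N → M ⊆ˢ N
  connectedModuleContaining-⊆ {N = N} (s , s∈S) noCommon
    ((_ , M⊆U , _ , connM) , S⊆M) ((_ , _ , homogN , _) , S⊆N) {y} y∈M with y ∈? N
  ... | yes y∈N = y∈N
  ... | no  y∉N with path-crossing N (connM s y (S⊆M s∈S) y∈M) (S⊆N s∈S) y∉N
  ... | w , z , w∈N , z∉N , z∈M , wz with homogN z (M⊆U z∈M) z∉N
  ... | inj₁ zSeesN = contradiction (M⊆U z∈M , λ {t} t∈S → zSeesN _ (S⊆N t∈S)) noCommon
  ... | inj₂ zMissesN = contradiction (Graph.sym G wz) (zMissesN w w∈N)

  connectedModuleContaining-unique : ∀ {U S} → Satisfiable S → (∀ {z} → ¬ CommonNeighbour U S z) →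
    ∀ {M N} → IsConnectedModuleContaining U S M → IsConnectedModuleContaining U S N → M ≡ N
  connectedModuleContaining-unique S≢∅ noCommon M N =
    ⊆-antisym (connectedModuleContaining-⊆ S≢∅ noCommon M N)
              (connectedModuleContaining-⊆ S≢∅ noCommon N M)

  IsConnectedModuleIn-restrict : ∀ {U U′ M} → U′ ⊆ᵖ U → (∀ {y} → y ∈ M → U′ y) →
    IsConnectedModuleIn U M → IsConnectedModuleIn U′ M
  IsConnectedModuleIn-restrict U′⊆U M⊆U′ (M≢∅ , _ , homog , conn) =
    M≢∅ , M⊆U′ , (λ u u∈U′ → homog u (U′⊆U u∈U′)) , conn

  connectedModulesContaining-atMost : ∀ j {U S} → Satisfiable S →
    CommonNeighbourCliqueBound U S j → AtMost (2 ^ j) (IsConnectedModuleContaining U S)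
  connectedModulesContaining-atMost zero S≢∅ bound =
    atMost-one (connectedModuleContaining-unique S≢∅ (cliqueBound-zero bound))
  connectedModulesContaining-atMost (suc j) {U} {S} S≢∅@(s , s∈S) bound {Ms} uniq all =
    -- Adj is not decidable: splitting on whether a common neighbour exists is justified by the goal being decidable.
    decidable-byCases (length Ms ≤? 2 ^ suc j) λ where
      (no noCommon) →
        atMost-weaken (m^n>0 2 (suc j))
          (atMost-one (connectedModuleContaining-unique S≢∅ (noCommon ∘ (_ ,_)))) uniq all
      (yes (x , x∈N)) →
        atMost-weaken (≤-reflexive (cong (2 ^ j +_) (≡.sym (+-identityʳ (2 ^ j)))))
          (atMost-split (x ∈?_) (containing x∈N) (avoiding x∈N)) uniq all
    where
    containing : ∀ {x} → CommonNeighbour U S x →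
      AtMost (2 ^ j) (IsConnectedModuleContaining U S ∩ (x ∈_))
    containing {x} x∈N =
      atMost-⊆ (λ ((M , S⊆M) , x∈M) → M , λ { (inj₁ t∈S) → S⊆M t∈S ; (inj₂ refl) → x∈M })
        (connectedModulesContaining-atMost j {U} {λ y → S y ⊎ y ≡ x} (s , inj₁ s∈S)
          (cliqueBound-pred bound x∈N
            λ (y∈U , y∼S∪x) → (y∈U , y∼S∪x ∘ inj₁) , Graph.sym G (y∼S∪x (inj₂ refl))))
    avoiding : ∀ {x} → CommonNeighbour U S x →
      AtMost (2 ^ j) (IsConnectedModuleContaining U S ∩ ∁ (x ∈_))
    avoiding {x} x∈N@(x∈U , x∼S) =
      atMost-⊆ inNeighbourhood
        (connectedModulesContaining-atMost j {λ y → U y × Adj G x y} {S} S≢∅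
          (cliqueBound-pred bound x∈N λ ((y∈U , xy) , y∼S) → (y∈U , y∼S) , xy))
      where
      inNeighbourhood : ∀ {M} → (IsConnectedModuleContaining U S ∩ ∁ (x ∈_)) M →
        IsConnectedModuleContaining (λ y → U y × Adj G x y) S M
      inNeighbourhood ((M@(_ , M⊆U , homog , _) , S⊆M) , x∉M) with homog x x∈U x∉M
      ... | inj₁ x∼M  = IsConnectedModuleIn-restrict proj₁ (λ y∈M → M⊆U y∈M , x∼M _ y∈M) M , S⊆M
      ... | inj₂ x≁M = contradiction (x∼S s∈S) (x≁M s (S⊆M s∈S))

  module _ {k : ℕ} (cliqueBound : ∀ C → IsClique G C → ∣ C ∣ ≤ k) where

    connectedModulesBelow-atMost : ∀ m → m ≤ n →
      AtMost (2 ^ k * m) (IsConnectedModuleIn (λ y → toℕ y < m))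
    connectedModulesBelow-atMost zero    _ {[]}    _ _ = z≤n
    connectedModulesBelow-atMost zero    _ {_ ∷ _} _ (((y , y∈M) , M⊆U , _) ∷ _) with M⊆U y∈M
    ... | ()
    connectedModulesBelow-atMost (suc m) m<n =
      atMost-weaken (≤-reflexive (≡.sym (*-suc (2 ^ k) m)))
        (atMost-split (v ∈?_) containing avoiding)
      where
      v : Fin n
      v = fromℕ< m<n
      containing : AtMost (2 ^ k) (IsConnectedModuleIn (λ y → toℕ y < suc m) ∩ (v ∈_))
      containing = atMost-⊆ (λ (M , v∈M) → M , λ { refl → v∈M })
        (connectedModulesContaining-atMost k {S = _≡ v} (v , refl) λ C clique _ → cliqueBound C clique)
      below : ∀ {M y} → v ∉ M → y ∈ M → toℕ y < suc m → toℕ y < m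
      below v∉M y∈M y<1+m = ≤∧≢⇒< (≤-pred y<1+m) λ y≡m →
        v∉M (subst (_∈ _) (toℕ-injective (trans y≡m (≡.sym (toℕ-fromℕ< m<n)))) y∈M)
      avoiding : AtMost (2 ^ k * m) (IsConnectedModuleIn (λ y → toℕ y < suc m) ∩ ∁ (v ∈_))
      avoiding = atMost-⊆
        (λ (M@(_ , M⊆U , _) , v∉M) →
          IsConnectedModuleIn-restrict m<n⇒m<1+n (λ y∈M → below v∉M y∈M (M⊆U y∈M)) M)
        (connectedModulesBelow-atMost m (<⇒≤ m<n))

    connectedModules-atMost : AtMost (2 ^ k * n) (IsConnectedModule G)
    connectedModules-atMost = atMost-⊆
      (λ ((M≢∅ , homog) , conn) → M≢∅ , (λ {y} _ → toℕ<n y) , (λ u _ → homog u) , conn)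
      (connectedModulesBelow-atMost n ≤-refl)

n≤2n∸1 : ∀ n → n ≤ 2 * n ∸ 1
n≤2n∸1 zero    = z≤n
n≤2n∸1 (suc n) = subst (suc n ≤_) (≡.sym (+-suc n (n + 0))) (s≤s (m≤m+n n (n + 0)))

corollary6 : (n k : ℕ) (G : Graph n) → CliqueNumber G k →
    (Ms : List (Subset n)) → Unique Ms → All (IsConnectedModule G) Ms →
    length Ms ≤ 2 ^ k * (2 * n ∸ 1)
corollary6 n k G (_ , cliqueBound) Ms uniq all =
  ≤-trans (connectedModules-atMost G cliqueBound uniq all) (*-monoʳ-≤ (2 ^ k) (n≤2n∸1 n))
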